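{- Let $t$ be a $\beta(1,0)$-tree with root label $k\ge 1$, and let $1\le i\le k$. Then $\mathrm{leaves}\,\lambda(i,t)=\mathrm{leaves}\,t$; $\mathrm{root}\,\lambda(i,t)=i$; $\mathrm{lpath}\,\lambda(i,t)=\mathrm{lpath}\,t+1$; $\mathrm{rpath}\,\lambda(i,t)=\mathrm{rpath}\,t+1$; $\mathrm{lsub}\,\lambda(i,t)=\mathrm{lsub}\,t+1$ if $i=1$ and $\mathrm{lsub}\,\lambda(i,t)=\mathrm{lsub}\,t$ if $i>1$; $\mathrm{stem}_{\mathrm{hm}}\,\lambda(i,t)=i$ if $i\le \mathrm{stem}_{\mathrm{hm}}\,t$ and $\mathrm{stem}_{\mathrm{hm}}\,\lambda(i,t)=\mathrm{stem}_{\mathrm{hm}}\,t$ if $i>\mathrm{stem}_{\mathrm{hm}}\,t$.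
   Context: A $\beta(1,0)$-tree is a rooted plane tree with at least one edge whose nodes are labeled by positive integers such that leaves have label 1, the root has label equal to the sum of its children's labels, and every other node has label at most the sum of its children's labels. For such a tree $t$ with root label $k$ and $1\le i\le k$, $\lambda(i,t)$ is the tree obtained by adding a new root joined by an edge to the old root, and giving both the new root and the old root the label $i$. Statistics: $\mathrm{leaves}(t)$ = number of leaves; $\mathrm{root}(t)$ = root label; the left path (right path) is the path from the root to the leftmost (rightmost) leaf, and $\mathrm{lpath}(t)$, $\mathrm{rpath}(t)$ are their numbers of edges; $\mathrm{lsub}(t)$ = number of nodes with label 1 on the left path other than the root. $\mathrm{stem}_{\mathrm{hm}}(t)$: let $\ell_1,\dots,\ell_m$ be the leaves of $t$ from left to right. Starting with $j=1$: if no node on the path from $\ell_j$ to the root other than $\ell_j$ itself has label 1 (in the current tree), decrease by 1 the labels of all nodes on that path, delete $\ell_j$, and proceed to $j+1$; the first $j$ for which the path from $\ell_j$ to the root contains a node other than $\ell_j$ with (current) label 1 is $\mathrm{stem}_{\mathrm{hm}}(t)$. -}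

module Defs where

open import Data.Nat using (ℕ; zero; suc; _+_; _≤_; pred; _≡ᵇ_)
open import Data.Bool using (Bool; true; false; if_then_else_)
open import Data.List using (List; []; _∷_; map)
open import Data.Bool.ListAction using (any)
open import Data.List.Relation.Unary.All using (All)
open import Data.Product using (_×_)
open import Data.Unit using (⊤)
open import Data.Empty using (⊥)
open import Relation.Binary.PropositionalEquality using (_≡_)

data Tree : Set where
  node : ℕ → List Tree → Tree

label : Tree → ℕ
label (node x _) = x

sumL : List Tree → ℕ
sumL [] = 0
sumL (c ∷ cs) = label c + sumL cs

data Good : Tree → Set where
  leaf  : Good (node 1 [])
  inner : ∀ {x c cs} → 1 ≤ x → x ≤ sumL (c ∷ cs) → All Good (c ∷ cs) →
          Good (node x (c ∷ cs))

Beta : Tree → Set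
Beta (node k []) = ⊥
Beta (node k (c ∷ cs)) = (k ≡ sumL (c ∷ cs)) × All Good (c ∷ cs)

lam : ℕ → Tree → Tree
lam i (node _ cs) = node i (node i cs ∷ [])

mutual
  leaves : Tree → ℕ
  leaves (node _ []) = 1
  leaves (node _ (c ∷ cs)) = leavesL (c ∷ cs)

  leavesL : List Tree → ℕ
  leavesL [] = 0
  leavesL (c ∷ cs) = leaves c + leavesL cs

root : Tree → ℕ
root = label

lpath : Tree → ℕ
lpath (node _ []) = 0
lpath (node _ (c ∷ _)) = suc (lpath c)

mutual
  rpath : Tree → ℕ
  rpath (node _ []) = 0
  rpath (node _ (c ∷ cs)) = suc (rpathL c cs)

  rpathL : Tree → List Tree → ℕ
  rpathL c [] = rpath c
  rpathL _ (d ∷ ds) = rpathL d ds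

one? : ℕ → ℕ
one? x = if x ≡ᵇ 1 then 1 else 0

lsubFrom : Tree → ℕ
lsubFrom (node x []) = one? x
lsubFrom (node x (c ∷ _)) = one? x + lsubFrom c

lsub : Tree → ℕ
lsub (node _ []) = 0
lsub (node _ (c ∷ _)) = lsubFrom c

-- The state is the list of
-- CURRENT labels of the strict ancestors of the node being visited, and the
-- index j of the next leaf.  At leaf ℓ_j: if some ancestor currently has
-- label 1, stop with j; otherwise decrease every ancestor label by 1
-- (the leaf itself is deleted) and continue with j+1.
-- (Labels are in ℕ; once a label reaches 0 it can never equal 1 again, so
-- the truncated predecessor does not affect the test "label = 1".)
data Res : Set where
  stop : ℕ → Res
  go   : List ℕ → ℕ → Res

popRes : Res → Res
popRes (stop j) = stop j
popRes (go [] j) = go [] j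
popRes (go (_ ∷ a) j) = go a j

mutual
  runT : List ℕ → ℕ → Tree → Res
  runT anc j (node x []) =
    if any (λ y → y ≡ᵇ 1) anc then stop j else go (map pred anc) (suc j)
  runT anc j (node x (c ∷ cs)) = popRes (runL (x ∷ anc) j (c ∷ cs))

  runL : List ℕ → ℕ → List Tree → Res
  runL anc j [] = go anc j
  runL anc j (c ∷ cs) = bindL (runT anc j c) cs

  bindL : Res → List Tree → Res
  bindL (stop n) _ = stop n
  bindL (go a j) cs = runL a j cs

-- stem_hm t (leaves numbered from 1).  If the procedure never stops
-- (impossible for β(1,0)-trees) the default value is leaves t + 1.
stemHm : Tree → ℕ
stemHm t with runT [] 1 t
... | stop j = j
... | go _ j = j

-- For stem_hm, the
-- leaf-by-leaf procedure on λ(i,t) is the procedure on t with two extra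
-- outermost ancestors of label i.  An outermost ancestor of label k is
-- decremented once per processed leaf, so it reaches label 1 exactly at leaf k
-- and otherwise never interferes; it therefore caps the stopping index at k.
-- Hence, writing s for the index of the procedure on the subtrees of the root,
-- stem t = k ⊓ s and stem λ(i,t) = i ⊓ (i ⊓ s) = i ⊓ stem t, because i ≤ k.
module Submission where

open import Defs
open import Data.Nat using (ℕ; zero; suc; _+_; _∸_; _⊓_; _≡ᵇ_; _≤_; _<_; _<?_; pred; s≤s)
open import Data.Nat.Properties
open import Data.Bool using (Bool; true; false; _∨_; if_then_else_)
open import Data.Bool.Properties using (∨-assoc)
open import Data.Bool.ListAction using (any)
open import Data.List using (List; []; _∷_; map; _++_; [_]; length)
open import Data.List.Properties using (map-++; length-map)
open import Data.Product using (_×_; _,_)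
open import Data.Unit using (⊤; tt)
open import Data.Empty using (⊥-elim)
open import Relation.Nullary using (yes; no)
open import Relation.Binary.PropositionalEquality using (_≡_; refl; sym; trans; cong; module ≡-Reasoning)

isOne : ℕ → Bool
isOne y = y ≡ᵇ 1

any-++ : ∀ {A : Set} (p : A → Bool) xs ys → any p (xs ++ ys) ≡ any p xs ∨ any p ys
any-++ p []       ys = refl
any-++ p (x ∷ xs) ys = trans (cong (p x ∨_) (any-++ p xs ys)) (sym (∨-assoc (p x) _ _))

index : Res → ℕ
index (stop j) = j
index (go _ j) = j

index-popRes : ∀ R → index (popRes R) ≡ index R
index-popRes (stop _)       = refl
index-popRes (go [] _)      = refl
index-popRes (go (_ ∷ _) _) = refl

mutual
  ≤-index-runT : ∀ anc j t → j ≤ index (runT anc j t)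
  ≤-index-runT anc j (node x []) with any isOne anc
  ... | true  = ≤-refl
  ... | false = n≤1+n j
  ≤-index-runT anc j (node x (c ∷ cs)) =
    ≤-trans (≤-index-runL (x ∷ anc) j (c ∷ cs)) (≤-reflexive (sym (index-popRes (runL (x ∷ anc) j (c ∷ cs)))))

  ≤-index-runL : ∀ anc j cs → j ≤ index (runL anc j cs)
  ≤-index-runL anc j []       = ≤-refl
  ≤-index-runL anc j (c ∷ cs) = ≤-trans (≤-index-runT anc j c) (≤-index-bindL (runT anc j c) cs)

  ≤-index-bindL : ∀ R cs → index R ≤ index (bindL R cs)
  ≤-index-bindL (stop _)  cs = ≤-refl
  ≤-index-bindL (go a j) cs = ≤-index-runL a j cs

-- popRes on an empty stack is a no-op, so it commutes with appending an outermost
-- ancestor only on runs that still carry a stack of known positive size.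
StackSize : ℕ → Res → Set
StackSize n (stop _) = ⊤
StackSize n (go a _) = length a ≡ n

stackSize-popRes : ∀ n R → StackSize (suc n) R → StackSize n (popRes R)
stackSize-popRes n (stop _)       _  = tt
stackSize-popRes n (go (_ ∷ a) _) eq = suc-injective eq

mutual
  stackSize-runT : ∀ anc j t → StackSize (length anc) (runT anc j t)
  stackSize-runT anc j (node x []) with any isOne anc
  ... | true  = tt
  ... | false = length-map pred anc
  stackSize-runT anc j (node x (c ∷ cs)) =
    stackSize-popRes (length anc) (runL (x ∷ anc) j (c ∷ cs)) (stackSize-runL (x ∷ anc) j (c ∷ cs))

  stackSize-runL : ∀ anc j cs → StackSize (length anc) (runL anc j cs)
  stackSize-runL anc j []       = refl
  stackSize-runL anc j (c ∷ cs) = stackSize-bindL (runT anc j c) cs (stackSize-runT anc j c)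

  stackSize-bindL : ∀ {n} R cs → StackSize n R → StackSize n (bindL R cs)
  stackSize-bindL (stop _)  cs _    = tt
  stackSize-bindL (go a j) cs refl = stackSize-runL a j cs

-- The run with one extra outermost ancestor which reaches label 1 exactly at leaf t:
-- the run stops at leaf t at the latest, and otherwise the extra label just counts down.
withDeadline : ℕ → Res → Res
withDeadline t (stop m) = stop (t ⊓ m)
withDeadline t (go a j) with t <? j
... | yes _ = stop t
... | no  _ = go (a ++ [ suc (t ∸ j) ]) j

index-withDeadline : ∀ t R → index (withDeadline t R) ≡ t ⊓ index R
index-withDeadline t (stop m) = refl
index-withDeadline t (go a j) with t <? j
... | yes t<j = sym (m≤n⇒m⊓n≡m (<⇒≤ t<j))
... | no  t≮j = sym (m≥n⇒m⊓n≡n (≮⇒≥ t≮j))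

withDeadline-passed : ∀ t R → t < index R → withDeadline t R ≡ stop t
withDeadline-passed t (stop m) t<m = cong stop (m≤n⇒m⊓n≡m (<⇒≤ t<m))
withDeadline-passed t (go a j) t<j with t <? j
... | yes _   = refl
... | no  t≮j = ⊥-elim (t≮j t<j)

popRes-withDeadline : ∀ {n} t R → StackSize (suc n) R → popRes (withDeadline t R) ≡ withDeadline t (popRes R)
popRes-withDeadline t (stop m)       _ = refl
popRes-withDeadline t (go (_ ∷ a) j) _ with t <? j
... | yes _ = refl
... | no  _ = refl

-- An outermost ancestor carrying label suc d when leaf j is visited reaches 1 at leaf d + j.
mutual
  runT-++-ancestor : ∀ xs d j t → runT (xs ++ [ suc d ]) j t ≡ withDeadline (d + j) (runT xs j t)
  runT-++-ancestor xs d j (node x [])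
    rewrite any-++ isOne xs [ suc d ] | map-++ pred xs [ suc d ] with any isOne xs
  ... | true  = cong stop (sym (m≥n⇒m⊓n≡n (m≤n+m j d)))
  ... | false = leafCase d
    where
    leafCase : ∀ d → (if (d ≡ᵇ 0) ∨ false then stop j else go (map pred xs ++ [ d ]) (suc j))
                     ≡ withDeadline (d + j) (go (map pred xs) (suc j))
    leafCase zero with j <? suc j
    ... | yes _   = refl
    ... | no  j≮ = ⊥-elim (j≮ (n<1+n j))
    leafCase (suc d) with suc d + j <? suc j
    ... | yes lt = ⊥-elim (<⇒≱ lt (s≤s (m≤n+m j d)))
    ... | no  _  = cong (λ e → go (map pred xs ++ [ e ]) (suc j)) (sym (cong suc (m+n∸n≡m d j)))
  runT-++-ancestor xs d j (node x (c ∷ cs)) =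
    trans (cong popRes (runL-++-ancestor (x ∷ xs) d j (c ∷ cs)))
          (popRes-withDeadline (d + j) (runL (x ∷ xs) j (c ∷ cs)) (stackSize-runL (x ∷ xs) j (c ∷ cs)))

  runL-++-ancestor : ∀ xs d j cs → runL (xs ++ [ suc d ]) j cs ≡ withDeadline (d + j) (runL xs j cs)
  runL-++-ancestor xs d j [] with d + j <? j
  ... | yes lt = ⊥-elim (<⇒≱ lt (m≤n+m j d))
  ... | no  _  = cong (λ e → go (xs ++ [ suc e ]) j) (sym (m+n∸n≡m d j))
  runL-++-ancestor xs d j (c ∷ cs) =
    trans (cong (λ R → bindL R cs) (runT-++-ancestor xs d j c)) (bindL-withDeadline (d + j) (runT xs j c) cs)

  bindL-withDeadline : ∀ t R cs → bindL (withDeadline t R) cs ≡ withDeadline t (bindL R cs)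
  bindL-withDeadline t (stop m) cs = refl
  bindL-withDeadline t (go a j) cs with t <? j
  ... | yes t<j = sym (withDeadline-passed t (runL a j cs) (<-≤-trans t<j (≤-index-runL a j cs)))
  ... | no  t≮j = begin
      runL (a ++ [ suc (t ∸ j) ]) j cs             ≡⟨ runL-++-ancestor a (t ∸ j) j cs ⟩
      withDeadline (t ∸ j + j) (runL a j cs)       ≡⟨ cong (λ s → withDeadline s (runL a j cs)) (m∸n+n≡m (≮⇒≥ t≮j)) ⟩
      withDeadline t (runL a j cs)                 ∎
    where open ≡-Reasoning

index-runL-++-ancestor : ∀ xs k cs → 1 ≤ k → index (runL (xs ++ [ k ]) 1 cs) ≡ k ⊓ index (runL xs 1 cs)
index-runL-++-ancestor xs (suc d) cs _ = begin
  index (runL (xs ++ [ suc d ]) 1 cs)             ≡⟨ cong index (runL-++-ancestor xs d 1 cs) ⟩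
  index (withDeadline (d + 1) (runL xs 1 cs))     ≡⟨ index-withDeadline (d + 1) (runL xs 1 cs) ⟩
  (d + 1) ⊓ index (runL xs 1 cs)                  ≡⟨ cong (_⊓ index (runL xs 1 cs)) (+-comm d 1) ⟩
  suc d ⊓ index (runL xs 1 cs)                    ∎
  where open ≡-Reasoning

stemHm≡index : ∀ t → stemHm t ≡ index (runT [] 1 t)
stemHm≡index t with runT [] 1 t
... | stop _ = refl
... | go _ _ = refl

stemHm-node : ∀ k c cs → 1 ≤ k → stemHm (node k (c ∷ cs)) ≡ k ⊓ index (runL [] 1 (c ∷ cs))
stemHm-node k c cs 1≤k = begin
  stemHm (node k (c ∷ cs))                     ≡⟨ stemHm≡index (node k (c ∷ cs)) ⟩
  index (popRes (runL [ k ] 1 (c ∷ cs)))       ≡⟨ index-popRes (runL [ k ] 1 (c ∷ cs)) ⟩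
  index (runL [ k ] 1 (c ∷ cs))                ≡⟨ index-runL-++-ancestor [] k (c ∷ cs) 1≤k ⟩
  k ⊓ index (runL [] 1 (c ∷ cs))               ∎
  where open ≡-Reasoning

stemHm-lam : ∀ i k c cs → 1 ≤ i → i ≤ k → stemHm (lam i (node k (c ∷ cs))) ≡ i ⊓ stemHm (node k (c ∷ cs))
stemHm-lam i k c cs 1≤i i≤k = begin
  stemHm (lam i (node k cs′))                           ≡⟨ stemHm≡index (lam i (node k cs′)) ⟩
  index (popRes (bindL (runT [ i ] 1 (node i cs′)) [])) ≡⟨ index-popRes (bindL (runT [ i ] 1 (node i cs′)) []) ⟩
  index (bindL (runT [ i ] 1 (node i cs′)) [])          ≡⟨ index-bindL-[] (runT [ i ] 1 (node i cs′)) ⟩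
  index (popRes (runL ([ i ] ++ [ i ]) 1 cs′))          ≡⟨ index-popRes (runL ([ i ] ++ [ i ]) 1 cs′) ⟩
  index (runL ([ i ] ++ [ i ]) 1 cs′)                   ≡⟨ index-runL-++-ancestor [ i ] i cs′ 1≤i ⟩
  i ⊓ index (runL [ i ] 1 cs′)                          ≡⟨ cong (i ⊓_) (index-runL-++-ancestor [] i cs′ 1≤i) ⟩
  i ⊓ (i ⊓ s₀)                                          ≡⟨ sym (⊓-assoc i i s₀) ⟩
  (i ⊓ i) ⊓ s₀                                          ≡⟨ cong (_⊓ s₀) (trans (⊓-idem i) (sym (m≤n⇒m⊓n≡m i≤k))) ⟩
  (i ⊓ k) ⊓ s₀                                          ≡⟨ ⊓-assoc i k s₀ ⟩
  i ⊓ (k ⊓ s₀)                                          ≡⟨ cong (i ⊓_) (sym (stemHm-node k c cs (≤-trans 1≤i i≤k))) ⟩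
  i ⊓ stemHm (node k cs′)                               ∎
  where
  open ≡-Reasoning
  cs′ : List Tree
  cs′ = c ∷ cs
  s₀ : ℕ
  s₀ = index (runL [] 1 cs′)
  index-bindL-[] : ∀ R → index (bindL R []) ≡ index R
  index-bindL-[] (stop _) = refl
  index-bindL-[] (go _ _) = refl

1<⇒one?≡0 : ∀ {i} → 1 < i → one? i ≡ 0
1<⇒one?≡0 {suc zero}    (s≤s ())
1<⇒one?≡0 {suc (suc _)} _ = refl

lemma4 : (t : Tree) → Beta t → (i : ℕ) → 1 ≤ i → i ≤ root t →
    (leaves (lam i t) ≡ leaves t)
    × (root (lam i t) ≡ i)
    × (lpath (lam i t) ≡ suc (lpath t))
    × (rpath (lam i t) ≡ suc (rpath t))
    × (i ≡ 1 → lsub (lam i t) ≡ suc (lsub t))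
    × (1 < i → lsub (lam i t) ≡ lsub t)
    × (i ≤ stemHm t → stemHm (lam i t) ≡ i)
    × (stemHm t < i → stemHm (lam i t) ≡ stemHm t)
lemma4 (node k (c ∷ cs)) _ i 1≤i i≤k =
    +-identityʳ _ , refl , refl , refl
  , (λ { refl → refl })
  , (λ 1<i → cong (_+ lsubFrom c) (1<⇒one?≡0 1<i))
  , (λ i≤s → trans stem-lam (m≤n⇒m⊓n≡m i≤s))
  , (λ s<i → trans stem-lam (m≥n⇒m⊓n≡n (<⇒≤ s<i)))
  where
  stem-lam : stemHm (lam i (node k (c ∷ cs))) ≡ i ⊓ stemHm (node k (c ∷ cs))
  stem-lam = stemHm-lam i k c cs 1≤i i≤k
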